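{- For any interval order $R$ on a finite set $X$, its Fishburn triple of type 1 $(T_1,S_1,R)$ and its Fishburn triple of type 2 $(T_2,S_2,R)$ are Fishburn triples.
   Context: A Fishburn triple is a triple $(T,S,R)$ of relations on a finite set $X$ such that: (Fa) $S$, $R$ and $T\cup R$ are partial orders (irreflexive, transitive); (Fb) any two distinct elements are comparable ($xQy$ or $yQx$) by exactly one of $T,S,R$; (C1c) for distinct $x,y,z$ with $xSy$, $yRz$ we have $xRz$; (C1c*) for distinct $x,y,z$ with $xSy$, $zRy$ we have $zRx$; (C2c) no distinct $x,y,z$ with $xTy$, $xTz$, $yRz$, and no $x,y,z$ with $yTx$, $zTx$, $zRy$. An interval order is a $\mathbf{2+2}$-free poset; it has a unique minimal interval representation $x\mapsto[l_x,r_x]$ with positive integer endpoints, $x\prec y$ iff $r_x<l_y$, every $k\in\{1,\dots,m\}$ both a left and right endpoint; its Fishburn matrix $M$ is $m\times m$ with $M_{i,j}=|\{x:[l_x,r_x]=[i,j]\}|$ (rows top to bottom), $x$ represented by cell $c_x=(i,j)$, $X_c$ the set of elements represented by $c$. For cells $c=(i,j)$, $c'=(i',j')$: $c$ greater than $c'$ if $j'<i$, comparable if one is greater; South $i>i'$, $j=j'$; North $i<i'$, $j=j'$; West $i=i'$, $j<j'$; strictly SW $i>i'$, $j<j'$; strictly NW: incomparable with $i<i'$, $j<j'$; weakly SW: South, West or strictly SW; weakly NW: North, West or strictly NW. The F1-triple $(T_1,S_1,R)$: for $x,y$ in distinct cells, $xT_1y$ iff $c_x$ strictly NW from $c_y$,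 $xS_1y$ iff $c_x$ weakly SW from $c_y$; on each $X_c$, $S_1$ restricts to a linear order and $T_1$ has no pairs. The F2-triple $(T_2,S_2,R)$: for $x,y$ in distinct cells, $xT_2y$ iff $c_x$ weakly NW from $c_y$, $xS_2y$ iff $c_x$ strictly SW from $c_y$; on each $X_c$, $T_2$ restricts to a linear order and $S_2$ has no pairs. (These are unique up to isomorphism.) -}

module Defs where

open import Data.Nat using (ℕ; _<_; _≤_; _>_)
open import Data.Fin using (Fin)
open import Data.Product using (_×_; ∃; _,_)
open import Data.Sum using (_⊎_)
open import Relation.Nullary using (¬_)
open import Relation.Binary.PropositionalEquality using (_≡_; _≢_)
open import Function.Bundles using (_⇔_)

Rel : ℕ → Set₁
Rel n = Fin n → Fin n → Set

IsStrictPO : ∀ {n} → Rel n → Set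
IsStrictPO {n} Q = (∀ (x : Fin n) → ¬ Q x x)
                 × (∀ (x y z : Fin n) → Q x y → Q y z → Q x z)

_∪_ : ∀ {n} → Rel n → Rel n → Rel n
(P ∪ Q) x y = P x y ⊎ Q x y

Comp : ∀ {n} → Rel n → Fin n → Fin n → Set
Comp Q x y = Q x y ⊎ Q y x

ExactlyOne : Set → Set → Set → Set
ExactlyOne A B C = (A × ¬ B × ¬ C) ⊎ (¬ A × B × ¬ C) ⊎ (¬ A × ¬ B × C)

Distinct3 : ∀ {n} → Fin n → Fin n → Fin n → Set
Distinct3 x y z = x ≢ y × y ≢ z × x ≢ z

IsFishburnTriple : ∀ {n} → Rel n → Rel n → Rel n → Set
IsFishburnTriple {n} T S R =
  (IsStrictPO S × IsStrictPO R × IsStrictPO (T ∪ R))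
  × (∀ (x y : Fin n) → x ≢ y → ExactlyOne (Comp T x y) (Comp S x y) (Comp R x y))
  × (∀ (x y z : Fin n) → Distinct3 x y z → S x y → R y z → R x z)
  × (∀ (x y z : Fin n) → Distinct3 x y z → S x y → R z y → R z x)
  × (∀ (x y z : Fin n) → Distinct3 x y z → ¬ (T x y × T x z × R y z))
  × (∀ (x y z : Fin n) → ¬ (T y x × T z x × R z y))

-- Interval order: a 2+2-free (strict) poset
IsIntervalOrder : ∀ {n} → Rel n → Set
IsIntervalOrder {n} R = IsStrictPO R
  × (∀ (a b c d : Fin n) → ¬ (R a b × R c d × ¬ R a d × ¬ R c b))

-- (l , r) is the minimal interval representation of R with m endpoints:
-- x ↦ [l x , r x], endpoints in {1..m}, x R y iff r x < l y,
-- and every k ∈ {1..m} is both a left and a right endpoint.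
IsMinimalRep : ∀ {n} → Rel n → ℕ → (Fin n → ℕ) → (Fin n → ℕ) → Set
IsMinimalRep {n} R m l r =
    (∀ (x : Fin n) → 1 ≤ l x × l x ≤ r x × r x ≤ m)
  × (∀ (x y : Fin n) → R x y ⇔ (r x < l y))
  × (∀ (k : ℕ) → 1 ≤ k → k ≤ m → ∃ (λ x → l x ≡ k) × ∃ (λ y → r y ≡ k))

-- Cells of the Fishburn matrix: (row i , column j)
Cell : Set
Cell = ℕ × ℕ

Greater : Cell → Cell → Set
Greater (i , j) (i' , j') = j' < i

Comparable : Cell → Cell → Set
Comparable c c' = Greater c c' ⊎ Greater c' c

-- directions: "c is <dir> from c'"
South North West StrictSW StrictNW WeakSW WeakNW : Cell → Cell → Set
South (i , j) (i' , j') = i > i' × j ≡ j'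
North (i , j) (i' , j') = i < i' × j ≡ j'
West  (i , j) (i' , j') = i ≡ i' × j < j'
StrictSW (i , j) (i' , j') = i > i' × j < j'
StrictNW (i , j) (i' , j') = ¬ Comparable (i , j) (i' , j') × i < i' × j < j'
WeakSW c c' = South c c' ⊎ West c c' ⊎ StrictSW c c'
WeakNW c c' = North c c' ⊎ West c c' ⊎ StrictNW c c'

IsStrictLinearOn : ∀ {n} → (Fin n → Set) → Rel n → Set
IsStrictLinearOn {n} P Q =
    (∀ (x : Fin n) → P x → ¬ Q x x)
  × (∀ (x y z : Fin n) → P x → P y → P z → Q x y → Q y z → Q x z)
  × (∀ (x y : Fin n) → P x → P y → x ≢ y → Q x y ⊎ Q y x)

module _ {n : ℕ} (l r : Fin n → ℕ) where

  cell : Fin n → Cell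
  cell x = (l x , r x)

  InCell : Cell → Fin n → Set
  InCell c x = cell x ≡ c

  IsF1 : Rel n → Rel n → Set
  IsF1 T S =
      (∀ (x y : Fin n) → cell x ≢ cell y →
         (T x y ⇔ StrictNW (cell x) (cell y)) × (S x y ⇔ WeakSW (cell x) (cell y)))
    × (∀ (c : Cell) → IsStrictLinearOn (InCell c) S)
    × (∀ (x y : Fin n) → cell x ≡ cell y → ¬ T x y)

  IsF2 : Rel n → Rel n → Set
  IsF2 T S =
      (∀ (x y : Fin n) → cell x ≢ cell y →
         (T x y ⇔ WeakNW (cell x) (cell y)) × (S x y ⇔ StrictSW (cell x) (cell y)))
    × (∀ (c : Cell) → IsStrictLinearOn (InCell c) T)
    × (∀ (x y : Fin n) → cell x ≡ cell y → ¬ S x y)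

-- In both triples T and S only relate elements whose intervals overlap: T x y places the
-- interval of x weakly to the left of that of y, and S x y places it inside that of y.
-- Every Fishburn axiom thereby becomes a comparison of interval endpoints, except for pairs
-- represented by the same cell, which the prescribed linear orders take care of.  Only the
-- representation x R y ⇔ r x < l y (with l x ≤ r x) is used.
module Submission where

open import Defs
open import Data.Nat using (ℕ; _<_; _≤_; _≟_; _<?_)
open import Data.Nat.Properties
open import Data.Fin using (Fin)
open import Data.Product using (_×_; _,_; proj₁; proj₂)
open import Data.Product.Properties using (≡-dec; ,-injectiveˡ; ,-injectiveʳ)
open import Data.Sum using (_⊎_; inj₁; inj₂; [_,_]′; map; map₂)
open import Data.Empty using (⊥-elim)
open import Function using (_∘_)
open import Function.Bundles using (_⇔_; Equivalence)
open import Relation.Nullary using (¬_; yes; no; Dec)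
open import Relation.Nullary.Decidable using (map′; _⊎-dec_)
open import Relation.Binary.Definitions using (tri<; tri≈; tri>)
open import Relation.Binary.PropositionalEquality
open Equivalence

exactlyOne : {A B C : Set} → (A → ¬ B) → (A → ¬ C) → (B → ¬ C) →
             A ⊎ B ⊎ C → ExactlyOne A B C
exactlyOne a⇒¬b a⇒¬c b⇒¬c (inj₁ a)        = inj₁ (a , a⇒¬b a , a⇒¬c a)
exactlyOne a⇒¬b a⇒¬c b⇒¬c (inj₂ (inj₁ b)) = inj₂ (inj₁ ((λ a → a⇒¬b a b) , b , b⇒¬c b))
exactlyOne a⇒¬b a⇒¬c b⇒¬c (inj₂ (inj₂ c)) =
  inj₂ (inj₂ ((λ a → a⇒¬c a c) , (λ b → b⇒¬c b c) , c))

Comp-disjoint : ∀ {n} {P Q : Rel n} →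
                (∀ {x y} → P x y → ¬ Q x y) → (∀ {x y} → P x y → ¬ Q y x) →
                ∀ {x y} → Comp P x y → ¬ Comp Q x y
Comp-disjoint P⇒¬Q P⇒¬Q⁻¹ (inj₁ p) (inj₁ q) = P⇒¬Q p q
Comp-disjoint P⇒¬Q P⇒¬Q⁻¹ (inj₁ p) (inj₂ q) = P⇒¬Q⁻¹ p q
Comp-disjoint P⇒¬Q P⇒¬Q⁻¹ (inj₂ p) (inj₁ q) = P⇒¬Q⁻¹ p q
Comp-disjoint P⇒¬Q P⇒¬Q⁻¹ (inj₂ p) (inj₂ q) = P⇒¬Q p q

≤-pinch : ∀ {p q s} → p ≤ q → q ≤ s → p ≡ s → q ≡ p × q ≡ s
≤-pinch p≤q q≤p refl = ≤-antisym q≤p p≤q , ≤-antisym q≤p p≤q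

_≟ᶜ_ : (c c' : Cell) → Dec (c ≡ c')
_≟ᶜ_ = ≡-dec _≟_ _≟_

pattern vertical p   = inj₁ p
pattern horizontal p = inj₂ (inj₁ p)
pattern diagonal p   = inj₂ (inj₂ p)

incomparable⁺ : ∀ {a b c d} → a ≤ d → c ≤ b → ¬ Comparable (a , b) (c , d)
incomparable⁺ a≤d c≤b = [ (λ d<a → <⇒≱ d<a a≤d) , (λ b<c → <⇒≱ b<c c≤b) ]′

incomparable-sym : ∀ {c c'} → ¬ Comparable c c' → ¬ Comparable c' c
incomparable-sym nc = nc ∘ [ inj₂ , inj₁ ]′

StrictNW⁻ : ∀ {a b c d} → StrictNW (a , b) (c , d) → a < c × b < d × c ≤ b
StrictNW⁻ (nc , a<c , b<d) = a<c , b<d , ≮⇒≥ (nc ∘ inj₂)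

WeakSW⁺ : ∀ {a b c d} → c ≤ a → b ≤ d → (a , b) ≢ (c , d) → WeakSW (a , b) (c , d)
WeakSW⁺ c≤a b≤d ≢ with m≤n⇒m<n∨m≡n c≤a | m≤n⇒m<n∨m≡n b≤d
... | inj₁ c<a  | inj₁ b<d  = diagonal (c<a , b<d)
... | inj₁ c<a  | inj₂ refl = vertical (c<a , refl)
... | inj₂ refl | inj₁ b<d  = horizontal (refl , b<d)
... | inj₂ refl | inj₂ refl = ⊥-elim (≢ refl)

WeakSW⁻ : ∀ {a b c d} → WeakSW (a , b) (c , d) → c ≤ a × b ≤ d
WeakSW⁻ (vertical (c<a , refl))   = <⇒≤ c<a , ≤-refl
WeakSW⁻ (horizontal (refl , b<d)) = ≤-refl , <⇒≤ b<d
WeakSW⁻ (diagonal (c<a , b<d))    = <⇒≤ c<a , <⇒≤ b<d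

WeakNW⁺ : ∀ {a b c d} → a ≤ c → b ≤ d → ¬ Comparable (a , b) (c , d) → (a , b) ≢ (c , d) →
          WeakNW (a , b) (c , d)
WeakNW⁺ a≤c b≤d nc ≢ with m≤n⇒m<n∨m≡n a≤c | m≤n⇒m<n∨m≡n b≤d
... | inj₁ a<c  | inj₁ b<d  = diagonal (nc , a<c , b<d)
... | inj₁ a<c  | inj₂ refl = vertical (a<c , refl)
... | inj₂ refl | inj₁ b<d  = horizontal (refl , b<d)
... | inj₂ refl | inj₂ refl = ⊥-elim (≢ refl)

WeakNW⁻ : ∀ {a b c d} → a ≤ b → c ≤ d → WeakNW (a , b) (c , d) → a ≤ c × b ≤ d × c ≤ b
WeakNW⁻ a≤b c≤d (vertical (a<c , refl))   = <⇒≤ a<c , ≤-refl , c≤d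
WeakNW⁻ a≤b c≤d (horizontal (refl , b<d)) = ≤-refl , <⇒≤ b<d , a≤b
WeakNW⁻ a≤b c≤d (diagonal s) with StrictNW⁻ s
... | a<c , b<d , c≤b = <⇒≤ a<c , <⇒≤ b<d , c≤b

incomparable⇒StrictNW⊎WeakSW : ∀ {c c'} → ¬ Comparable c c' → c ≢ c' →
  (StrictNW c c' ⊎ StrictNW c' c) ⊎ (WeakSW c c' ⊎ WeakSW c' c)
incomparable⇒StrictNW⊎WeakSW {a , b} {c , d} nc ≢ with <-cmp a c | <-cmp b d
... | tri< a<c _ _  | tri< b<d _ _  = inj₁ (inj₁ (nc , a<c , b<d))
... | tri< a<c _ _  | tri≈ _ refl _ = inj₂ (inj₂ (vertical (a<c , refl)))
... | tri< a<c _ _  | tri> _ _ d<b  = inj₂ (inj₂ (diagonal (a<c , d<b)))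
... | tri≈ _ refl _ | tri< b<d _ _  = inj₂ (inj₁ (horizontal (refl , b<d)))
... | tri≈ _ refl _ | tri≈ _ refl _ = ⊥-elim (≢ refl)
... | tri≈ _ refl _ | tri> _ _ d<b  = inj₂ (inj₂ (horizontal (refl , d<b)))
... | tri> _ _ c<a  | tri< b<d _ _  = inj₂ (inj₁ (diagonal (c<a , b<d)))
... | tri> _ _ c<a  | tri≈ _ refl _ = inj₂ (inj₁ (vertical (c<a , refl)))
... | tri> _ _ c<a  | tri> _ _ d<b  = inj₁ (inj₂ (incomparable-sym nc , c<a , d<b))

incomparable⇒WeakNW⊎StrictSW : ∀ {c c'} → ¬ Comparable c c' → c ≢ c' →
  (WeakNW c c' ⊎ WeakNW c' c) ⊎ (StrictSW c c' ⊎ StrictSW c' c)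
incomparable⇒WeakNW⊎StrictSW {a , b} {c , d} nc ≢ with <-cmp a c | <-cmp b d
... | tri< a<c _ _  | tri< b<d _ _  = inj₁ (inj₁ (diagonal (nc , a<c , b<d)))
... | tri< a<c _ _  | tri≈ _ refl _ = inj₁ (inj₁ (vertical (a<c , refl)))
... | tri< a<c _ _  | tri> _ _ d<b  = inj₂ (inj₂ (a<c , d<b))
... | tri≈ _ refl _ | tri< b<d _ _  = inj₁ (inj₁ (horizontal (refl , b<d)))
... | tri≈ _ refl _ | tri≈ _ refl _ = ⊥-elim (≢ refl)
... | tri≈ _ refl _ | tri> _ _ d<b  = inj₁ (inj₂ (horizontal (refl , d<b)))
... | tri> _ _ c<a  | tri< b<d _ _  = inj₂ (inj₁ (c<a , b<d))
... | tri> _ _ c<a  | tri≈ _ refl _ = inj₁ (inj₂ (vertical (c<a , refl)))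
... | tri> _ _ c<a  | tri> _ _ d<b  = inj₁ (inj₂ (diagonal (incomparable-sym nc , c<a , d<b)))

module IntervalRepresentation {n : ℕ} (R : Rel n) (l r : Fin n → ℕ)
       (l≤r : ∀ x → l x ≤ r x) (R⇔ : ∀ x y → R x y ⇔ r x < l y) where

  R⁺ : ∀ {x y} → r x < l y → R x y
  R⁺ {x} {y} = from (R⇔ x y)

  R⁻ : ∀ {x y} → R x y → r x < l y
  R⁻ {x} {y} = to (R⇔ x y)

  R-isStrictPO : IsStrictPO R
  R-isStrictPO = (λ x xRx → <⇒≱ (R⁻ xRx) (l≤r x))
               , (λ x y z xRy yRz → R⁺ (<-trans (R⁻ xRy) (≤-<-trans (l≤r y) (R⁻ yRz))))

  CompR? : ∀ x y → Dec (Comp R x y)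
  CompR? x y = map′ R⁺ R⁻ (r x <? l y) ⊎-dec map′ R⁺ R⁻ (r y <? l x)

  ¬CompR⇒incomparable : ∀ {x y} → ¬ Comp R x y → ¬ Comparable (cell l r x) (cell l r y)
  ¬CompR⇒incomparable ¬xRy = [ ¬xRy ∘ inj₂ ∘ R⁺ , ¬xRy ∘ inj₁ ∘ R⁺ ]′

  Inside LeftOverlaps : Rel n
  Inside x y       = l y ≤ l x × r x ≤ r y
  LeftOverlaps x y = l x ≤ l y × r x ≤ r y × l y ≤ r x

  Inside⇒¬R : ∀ {x y} → Inside x y → ¬ R x y
  Inside⇒¬R {x} (ly≤lx , _) xRy = <⇒≱ (R⁻ xRy) (≤-trans ly≤lx (l≤r x))

  Inside⇒¬R⁻¹ : ∀ {x y} → Inside x y → ¬ R y x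
  Inside⇒¬R⁻¹ {x} (_ , rx≤ry) yRx = <⇒≱ (R⁻ yRx) (≤-trans (l≤r x) rx≤ry)

  LeftOverlaps⇒¬R : ∀ {x y} → LeftOverlaps x y → ¬ R x y
  LeftOverlaps⇒¬R (_ , _ , ly≤rx) xRy = <⇒≱ (R⁻ xRy) ly≤rx

  LeftOverlaps⇒¬R⁻¹ : ∀ {x y} → LeftOverlaps x y → ¬ R y x
  LeftOverlaps⇒¬R⁻¹ {y = y} (lx≤ly , _) yRx = <⇒≱ (R⁻ yRx) (≤-trans lx≤ly (l≤r y))

  module FishburnCriterion (T S : Rel n)
    (T⇒LeftOverlaps : ∀ {x y} → T x y → LeftOverlaps x y)
    (S⇒Inside : ∀ {x y} → S x y → Inside x y)
    (T-irrefl : ∀ x → ¬ T x x)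
    (S-isStrictPO : IsStrictPO S)
    (T∘T⊆T∪R : ∀ {x y z} → T x y → T y z → (T ∪ R) x z)
    (T⇒¬S : ∀ {x y} → T x y → ¬ S x y)
    (T⇒¬S⁻¹ : ∀ {x y} → T x y → ¬ S y x)
    (incomparable⇒CompT⊎CompS : ∀ {x y} → x ≢ y → ¬ Comp R x y → Comp T x y ⊎ Comp S x y)
    where

    T∪R-isStrictPO : IsStrictPO (T ∪ R)
    T∪R-isStrictPO = (λ x → [ T-irrefl x , proj₁ R-isStrictPO x ]′) , T∪R-trans
      where
      T∪R-trans : ∀ x y z → (T ∪ R) x y → (T ∪ R) y z → (T ∪ R) x z
      T∪R-trans x y z (inj₁ xTy) (inj₁ yTz) = T∘T⊆T∪R xTy yTz
      T∪R-trans x y z (inj₁ xTy) (inj₂ yRz) =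
        let (_ , rx≤ry , _) = T⇒LeftOverlaps xTy in inj₂ (R⁺ (≤-<-trans rx≤ry (R⁻ yRz)))
      T∪R-trans x y z (inj₂ xRy) (inj₁ yTz) =
        let (ly≤lz , _) = T⇒LeftOverlaps yTz in inj₂ (R⁺ (<-≤-trans (R⁻ xRy) ly≤lz))
      T∪R-trans x y z (inj₂ xRy) (inj₂ yRz) = inj₂ (proj₂ R-isStrictPO x y z xRy yRz)

    exactlyOne-TSR : ∀ x y → x ≢ y → ExactlyOne (Comp T x y) (Comp S x y) (Comp R x y)
    exactlyOne-TSR x y x≢y =
      exactlyOne CompT⇒¬CompS CompT⇒¬CompR CompS⇒¬CompR (cover (CompR? x y))
      where
      CompT⇒¬CompS : Comp T x y → ¬ Comp S x y
      CompT⇒¬CompS = Comp-disjoint {P = T} {Q = S} T⇒¬S T⇒¬S⁻¹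

      CompT⇒¬CompR : Comp T x y → ¬ Comp R x y
      CompT⇒¬CompR = Comp-disjoint {P = T} {Q = R}
        (LeftOverlaps⇒¬R ∘ T⇒LeftOverlaps) (LeftOverlaps⇒¬R⁻¹ ∘ T⇒LeftOverlaps)

      CompS⇒¬CompR : Comp S x y → ¬ Comp R x y
      CompS⇒¬CompR = Comp-disjoint {P = S} {Q = R}
        (Inside⇒¬R ∘ S⇒Inside) (Inside⇒¬R⁻¹ ∘ S⇒Inside)

      cover : Dec (Comp R x y) → Comp T x y ⊎ Comp S x y ⊎ Comp R x y
      cover (yes xRy) = inj₂ (inj₂ xRy)
      cover (no ¬xRy) = map₂ inj₁ (incomparable⇒CompT⊎CompS x≢y ¬xRy)

    isFishburnTriple : IsFishburnTriple T S R
    isFishburnTriple =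
        (S-isStrictPO , R-isStrictPO , T∪R-isStrictPO)
      , exactlyOne-TSR
      , (λ x y z _ xSy yRz → R⁺ (≤-<-trans (proj₂ (S⇒Inside xSy)) (R⁻ yRz)))
      , (λ x y z _ xSy zRy → R⁺ (<-≤-trans (R⁻ zRy) (proj₁ (S⇒Inside xSy))))
      , (λ { x y z _ (xTy , xTz , yRz) →
             let (_ , rx≤ry , _) = T⇒LeftOverlaps xTy
                 (_ , _ , lz≤rx) = T⇒LeftOverlaps xTz
             in <⇒≱ (R⁻ yRz) (≤-trans lz≤rx rx≤ry) })
      , (λ { x y z (yTx , zTx , zRy) →
             let (ly≤lx , _)     = T⇒LeftOverlaps yTx
                 (_ , _ , lx≤rz) = T⇒LeftOverlaps zTx
             in <⇒≱ (R⁻ zRy) (≤-trans ly≤lx lx≤rz) })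

  module F1 {T S : Rel n} (isF1 : IsF1 l r T S) where

    T⇔StrictNW : ∀ {x y} → cell l r x ≢ cell l r y → T x y ⇔ StrictNW (cell l r x) (cell l r y)
    T⇔StrictNW {x} {y} x≁y = proj₁ (proj₁ isF1 x y x≁y)

    S⇔WeakSW : ∀ {x y} → cell l r x ≢ cell l r y → S x y ⇔ WeakSW (cell l r x) (cell l r y)
    S⇔WeakSW {x} {y} x≁y = proj₂ (proj₁ isF1 x y x≁y)

    S-linear : ∀ c → IsStrictLinearOn (InCell l r c) S
    S-linear = proj₁ (proj₂ isF1)

    T-sameCell : ∀ {x y} → cell l r x ≡ cell l r y → ¬ T x y
    T-sameCell {x} {y} = proj₂ (proj₂ isF1) x y

    T⇒StrictNW : ∀ {x y} → T x y → StrictNW (cell l r x) (cell l r y)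
    T⇒StrictNW xTy = to (T⇔StrictNW (λ x~y → T-sameCell x~y xTy)) xTy

    T⇒LeftOverlaps : ∀ {x y} → T x y → LeftOverlaps x y
    T⇒LeftOverlaps xTy with StrictNW⁻ (T⇒StrictNW xTy)
    ... | lx<ly , rx<ry , ly≤rx = <⇒≤ lx<ly , <⇒≤ rx<ry , ly≤rx

    S⇒Inside : ∀ {x y} → S x y → Inside x y
    S⇒Inside {x} {y} xSy with cell l r x ≟ᶜ cell l r y
    ... | yes x~y = ≤-reflexive (sym (,-injectiveˡ x~y)) , ≤-reflexive (,-injectiveʳ x~y)
    ... | no x≁y  = WeakSW⁻ (to (S⇔WeakSW x≁y) xSy)

    S-trans : ∀ x y z → S x y → S y z → S x z
    S-trans x y z xSy ySz with S⇒Inside xSy | S⇒Inside ySz | cell l r x ≟ᶜ cell l r z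
    ... | ly≤lx , rx≤ry | lz≤ly , ry≤rz | yes x~z =
      proj₁ (proj₂ (S-linear (cell l r x))) x y z refl y~x (sym x~z) xSy ySz
      where
      y~x : cell l r y ≡ cell l r x
      y~x = cong₂ _,_ (proj₂ (≤-pinch lz≤ly ly≤lx (sym (,-injectiveˡ x~z))))
                      (proj₁ (≤-pinch rx≤ry ry≤rz (,-injectiveʳ x~z)))
    ... | ly≤lx , rx≤ry | lz≤ly , ry≤rz | no x≁z =
      from (S⇔WeakSW x≁z) (WeakSW⁺ (≤-trans lz≤ly ly≤lx) (≤-trans rx≤ry ry≤rz) x≁z)

    T∘T⊆T∪R : ∀ {x y z} → T x y → T y z → (T ∪ R) x z
    T∘T⊆T∪R {x} {y} {z} xTy yTz
      with StrictNW⁻ (T⇒StrictNW xTy) | StrictNW⁻ (T⇒StrictNW yTz) | r x <? l z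
    ... | _ | _ | yes rx<lz = inj₂ (R⁺ rx<lz)
    ... | lx<ly , rx<ry , _ | ly<lz , ry<rz , _ | no rx≮lz =
      inj₁ (from (T⇔StrictNW x≁z) (nc , lx<lz , rx<rz))
      where
      lx<lz : l x < l z
      lx<lz = <-trans lx<ly ly<lz
      rx<rz : r x < r z
      rx<rz = <-trans rx<ry ry<rz
      nc : ¬ Comparable (cell l r x) (cell l r z)
      nc = incomparable⁺ (≤-trans (l≤r x) (<⇒≤ rx<rz)) (≮⇒≥ rx≮lz)
      x≁z : cell l r x ≢ cell l r z
      x≁z x~z = <-irrefl (,-injectiveˡ x~z) lx<lz

    T⇒¬S : ∀ {x y} → T x y → ¬ S x y
    T⇒¬S xTy xSy =
      let (lx<ly , _) = StrictNW⁻ (T⇒StrictNW xTy) ; (ly≤lx , _) = S⇒Inside xSy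
      in <⇒≱ lx<ly ly≤lx

    T⇒¬S⁻¹ : ∀ {x y} → T x y → ¬ S y x
    T⇒¬S⁻¹ xTy ySx =
      let (_ , rx<ry , _) = StrictNW⁻ (T⇒StrictNW xTy) ; (_ , ry≤rx) = S⇒Inside ySx
      in <⇒≱ rx<ry ry≤rx

    incomparable⇒CompT⊎CompS : ∀ {x y} → x ≢ y → ¬ Comp R x y → Comp T x y ⊎ Comp S x y
    incomparable⇒CompT⊎CompS {x} {y} x≢y ¬xRy with cell l r x ≟ᶜ cell l r y
    ... | yes x~y = inj₂ (proj₂ (proj₂ (S-linear (cell l r x))) x y refl (sym x~y) x≢y)
    ... | no x≁y  =
      map (map (from (T⇔StrictNW x≁y)) (from (T⇔StrictNW (≢-sym x≁y))))
          (map (from (S⇔WeakSW x≁y)) (from (S⇔WeakSW (≢-sym x≁y))))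
          (incomparable⇒StrictNW⊎WeakSW (¬CompR⇒incomparable ¬xRy) x≁y)

    isFishburnTriple : IsFishburnTriple T S R
    isFishburnTriple = FishburnCriterion.isFishburnTriple T S
      T⇒LeftOverlaps S⇒Inside (λ x → T-sameCell refl)
      ((λ x → proj₁ (S-linear (cell l r x)) x refl) , S-trans)
      T∘T⊆T∪R T⇒¬S T⇒¬S⁻¹ incomparable⇒CompT⊎CompS

  module F2 {T S : Rel n} (isF2 : IsF2 l r T S) where

    T⇔WeakNW : ∀ {x y} → cell l r x ≢ cell l r y → T x y ⇔ WeakNW (cell l r x) (cell l r y)
    T⇔WeakNW {x} {y} x≁y = proj₁ (proj₁ isF2 x y x≁y)

    S⇔StrictSW : ∀ {x y} → cell l r x ≢ cell l r y → S x y ⇔ StrictSW (cell l r x) (cell l r y)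
    S⇔StrictSW {x} {y} x≁y = proj₂ (proj₁ isF2 x y x≁y)

    T-linear : ∀ c → IsStrictLinearOn (InCell l r c) T
    T-linear = proj₁ (proj₂ isF2)

    S-sameCell : ∀ {x y} → cell l r x ≡ cell l r y → ¬ S x y
    S-sameCell {x} {y} = proj₂ (proj₂ isF2) x y

    S⇒StrictSW : ∀ {x y} → S x y → StrictSW (cell l r x) (cell l r y)
    S⇒StrictSW xSy = to (S⇔StrictSW (λ x~y → S-sameCell x~y xSy)) xSy

    S⇒Inside : ∀ {x y} → S x y → Inside x y
    S⇒Inside xSy with S⇒StrictSW xSy
    ... | ly<lx , rx<ry = <⇒≤ ly<lx , <⇒≤ rx<ry

    T⇒LeftOverlaps : ∀ {x y} → T x y → LeftOverlaps x y
    T⇒LeftOverlaps {x} {y} xTy with cell l r x ≟ᶜ cell l r y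
    ... | yes x~y = ≤-reflexive (,-injectiveˡ x~y) , ≤-reflexive (,-injectiveʳ x~y)
                  , ≤-trans (≤-reflexive (sym (,-injectiveˡ x~y))) (l≤r x)
    ... | no x≁y  = WeakNW⁻ (l≤r x) (l≤r y) (to (T⇔WeakNW x≁y) xTy)

    S-trans : ∀ x y z → S x y → S y z → S x z
    S-trans x y z xSy ySz with S⇒StrictSW xSy | S⇒StrictSW ySz
    ... | ly<lx , rx<ry | lz<ly , ry<rz = from (S⇔StrictSW x≁z) (lz<lx , <-trans rx<ry ry<rz)
      where
      lz<lx : l z < l x
      lz<lx = <-trans lz<ly ly<lx
      x≁z : cell l r x ≢ cell l r z
      x≁z x~z = <-irrefl (sym (,-injectiveˡ x~z)) lz<lx

    T∘T⊆T∪R : ∀ {x y z} → T x y → T y z → (T ∪ R) x z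
    T∘T⊆T∪R {x} {y} {z} xTy yTz with T⇒LeftOverlaps xTy | T⇒LeftOverlaps yTz | r x <? l z
    ... | _ | _ | yes rx<lz = inj₂ (R⁺ rx<lz)
    ... | lx≤ly , rx≤ry , _ | ly≤lz , ry≤rz , _ | no rx≮lz with cell l r x ≟ᶜ cell l r z
    ...   | yes x~z =
      inj₁ (proj₁ (proj₂ (T-linear (cell l r x))) x y z refl y~x (sym x~z) xTy yTz)
      where
      y~x : cell l r y ≡ cell l r x
      y~x = cong₂ _,_ (proj₁ (≤-pinch lx≤ly ly≤lz (,-injectiveˡ x~z)))
                      (proj₁ (≤-pinch rx≤ry ry≤rz (,-injectiveʳ x~z)))
    ...   | no x≁z = inj₁ (from (T⇔WeakNW x≁z) (WeakNW⁺ lx≤lz rx≤rz nc x≁z))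
      where
      lx≤lz : l x ≤ l z
      lx≤lz = ≤-trans lx≤ly ly≤lz
      rx≤rz : r x ≤ r z
      rx≤rz = ≤-trans rx≤ry ry≤rz
      nc : ¬ Comparable (cell l r x) (cell l r z)
      nc = incomparable⁺ (≤-trans (l≤r x) rx≤rz) (≮⇒≥ rx≮lz)

    T⇒¬S : ∀ {x y} → T x y → ¬ S x y
    T⇒¬S xTy xSy =
      let (lx≤ly , _) = T⇒LeftOverlaps xTy ; (ly<lx , _) = S⇒StrictSW xSy
      in <⇒≱ ly<lx lx≤ly

    T⇒¬S⁻¹ : ∀ {x y} → T x y → ¬ S y x
    T⇒¬S⁻¹ xTy ySx =
      let (_ , rx≤ry , _) = T⇒LeftOverlaps xTy ; (_ , ry<rx) = S⇒StrictSW ySx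
      in <⇒≱ ry<rx rx≤ry

    incomparable⇒CompT⊎CompS : ∀ {x y} → x ≢ y → ¬ Comp R x y → Comp T x y ⊎ Comp S x y
    incomparable⇒CompT⊎CompS {x} {y} x≢y ¬xRy with cell l r x ≟ᶜ cell l r y
    ... | yes x~y = inj₁ (proj₂ (proj₂ (T-linear (cell l r x))) x y refl (sym x~y) x≢y)
    ... | no x≁y  =
      map (map (from (T⇔WeakNW x≁y)) (from (T⇔WeakNW (≢-sym x≁y))))
          (map (from (S⇔StrictSW x≁y)) (from (S⇔StrictSW (≢-sym x≁y))))
          (incomparable⇒WeakNW⊎StrictSW (¬CompR⇒incomparable ¬xRy) x≁y)

    isFishburnTriple : IsFishburnTriple T S R
    isFishburnTriple = FishburnCriterion.isFishburnTriple T S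
      T⇒LeftOverlaps S⇒Inside (λ x → proj₁ (T-linear (cell l r x)) x refl)
      ((λ x → S-sameCell refl) , S-trans)
      T∘T⊆T∪R T⇒¬S T⇒¬S⁻¹ incomparable⇒CompT⊎CompS

lemma3p4 : (n : ℕ) (R : Rel n) → IsIntervalOrder R →
           (m : ℕ) (l r : Fin n → ℕ) → IsMinimalRep R m l r →
           ((T S : Rel n) → IsF1 l r T S → IsFishburnTriple T S R)
           × ((T S : Rel n) → IsF2 l r T S → IsFishburnTriple T S R)
lemma3p4 n R _ m l r (bounds , R⇔ , _) =
    (λ T S isF1 → F1.isFishburnTriple isF1)
  , (λ T S isF2 → F2.isFishburnTriple isF2)
  where open IntervalRepresentation R l r (λ x → proj₁ (proj₂ (bounds x))) R⇔
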